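{- Let $G$ be a transitively closed directed acyclic graph with vertex set $[n]$ (edges $(i,j)$ with $i<j$), and let $H\subseteq G$ be a path consistent and admissible subgraph. Then there exist a partition $\mathcal P=\{P_i\}$ of $[n]$ and, for each $i$, disjoint subsets $L_i,R_i\subseteq P_i$ such that $H=\bigsqcup_{P_i\in\mathcal P}(G|_{P_i})_{L_i,R_i}$, i.e. $E(H)=\bigcup_i\{(a,b)\in E(G): a\in L_i,\ b\in R_i\}$.
   Context: $G$ is transitively closed if $(i,j),(j,k)\in E(G)$ imply $(i,k)\in E(G)$. $G|_P$ is the induced subgraph on $P$; for disjoint $L,R$ in its vertex set, $(G|_P)_{L,R}$ is the subgraph of $G|_P$ with edge set $\{(a,b)\in E(G|_P): a\in L, b\in R\}$. A subgraph $H\subseteq G$ has $V(H)=V(G)$, $E(H)\subseteq E(G)$; $H^{\mathrm{un}}$ is its underlying undirected graph. Signed length of an undirected path in $H^{\mathrm{un}}$ from $u$ to $v$: number of edges traversed in their direction minus number traversed against their direction. $H$ is path consistent if any two undirected paths in $H^{\mathrm{un}}$ with the same endpoints $u,v$ have equal signed length $\ell_{uv}$. Weight function $w$: on each component $C$ of $H^{\mathrm{un}}$, pick $u_*\in C$ with $\ell_{u_*v_*}=\max_{u,v\in C}\ell_{uv}$ for some $v_*$, and set $w(i)=\ell_{u_*i}$. $H_{\mathrm{comp}}$: multigraph whose vertices are the components of $H^{\mathrm{un}}$, with one edge $e$ from the component of $v$ to that of $v'$ for each $(v,v')\in E(G)\setminus E(H)$, with weight decrease $\mathsf{wd}(e)=w(v)-w(v')$.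 $H$ is admissible if for every directed cycle $\mathcal C$ of $H_{\mathrm{comp}}$ (loops included), $\sum_{e\in\mathcal C}\mathsf{wd}(e)>-|\mathcal C|$. -}

module Defs where

open import Data.Nat using (ℕ; zero; suc)
open import Data.Fin using (Fin; zero; suc; inject₁; fromℕ; _<_)
open import Data.Bool using (Bool; true; false)
open import Data.Integer as ℤ using (ℤ; +_; -_) renaming (_+_ to _+ℤ_; _-_ to _-ℤ_)
open import Data.List using (List; []; _∷_)
open import Data.List.Relation.Unary.Unique.Propositional using (Unique)
open import Data.Product using (Σ; ∃; _×_; _,_)
open import Relation.Binary.PropositionalEquality using (_≡_)
open import Relation.Nullary using (¬_)

Graph : ℕ → Set
Graph n = Fin n → Fin n → Bool

module _ {n : ℕ} where

  Edge : Graph n → Fin n → Fin n → Set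
  Edge E i j = E i j ≡ true

  EdgesIncreasing : Graph n → Set
  EdgesIncreasing G = ∀ i j → Edge G i j → i < j

  TransitivelyClosed : Graph n → Set
  TransitivelyClosed G = ∀ i j k → Edge G i j → Edge G j k → Edge G i k

  Subgraph : Graph n → Graph n → Set
  Subgraph H G = ∀ i j → Edge H i j → Edge G i j

  -- Undirected walks in H^un from u to v: each step traverses an edge of H
  -- either in its direction (fwd) or against it (bwd).
  data Walk (H : Graph n) : Fin n → Fin n → Set where
    nil : ∀ u → Walk H u u
    fwd : ∀ {u w v} → Edge H u w → Walk H w v → Walk H u v
    bwd : ∀ {u w v} → Edge H w u → Walk H w v → Walk H u v

  vertices : ∀ {H u v} → Walk H u v → List (Fin n)
  vertices (nil u) = u ∷ []
  vertices {u = u} (fwd _ p) = u ∷ vertices p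
  vertices {u = u} (bwd _ p) = u ∷ vertices p

  IsPath : ∀ {H u v} → Walk H u v → Set
  IsPath p = Unique (vertices p)

  slen : ∀ {H u v} → Walk H u v → ℤ
  slen (nil _) = + 0
  slen (fwd _ p) = + 1 +ℤ slen p
  slen (bwd _ p) = - (+ 1) +ℤ slen p

  PathConsistent : Graph n → Set
  PathConsistent H = ∀ u v (p q : Walk H u v) → IsPath p → IsPath q → slen p ≡ slen q

  Conn : Graph n → Fin n → Fin n → Set
  Conn H u v = Σ (Walk H u v) IsPath

  -- w is a weight function for H: s i is the chosen vertex u_* of the
  -- component of i (same choice on a whole component), with
  -- ℓ_{u_* v_*} maximal among all ℓ_{ab} in the component, and w i = ℓ_{u_* i}.
  IsWeight : Graph n → (Fin n → ℤ) → Set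
  IsWeight H w = Σ (Fin n → Fin n) λ s →
      (∀ i j → Conn H i j → s i ≡ s j)
    × (∀ i → Σ (Fin n) λ v* → Σ (Walk H (s i) v*) λ q → IsPath q
         × (∀ a b (r : Walk H a b) → IsPath r → Conn H (s i) a → slen r ℤ.≤ slen q))
    × (∀ i → Σ (Walk H (s i) i) λ p → IsPath p × w i ≡ slen p)

  Σℤ : ∀ {m} → (Fin m → ℤ) → ℤ
  Σℤ {zero} f = + 0
  Σℤ {suc m} f = f zero +ℤ Σℤ (λ j → f (suc j))

  -- A directed cycle of H_comp of length suc k: edges e_j = (src j , tgt j) of
  -- E(G) \ E(H); the head component of e_j is the tail component of e_{j+1}
  -- (cyclically); the visited components (tails) are pairwise distinct.
  record CompCycle (G H : Graph n) (k : ℕ) : Set where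
    field
      src tgt  : Fin (suc k) → Fin n
      inG      : ∀ j → Edge G (src j) (tgt j)
      notH     : ∀ j → H (src j) (tgt j) ≡ false
      link     : ∀ (j : Fin k) → Conn H (tgt (inject₁ j)) (src (suc j))
      close    : Conn H (tgt (fromℕ k)) (src zero)
      distinct : ∀ j j' → Conn H (src j) (src j') → j ≡ j'

  AdmissibleWrt : Graph n → Graph n → (Fin n → ℤ) → Set
  AdmissibleWrt G H w = ∀ k (C : CompCycle G H k) →
    let open CompCycle C in
    - (+ suc k) ℤ.< Σℤ (λ j → w (src j) -ℤ w (tgt j))

  Admissible : Graph n → Graph n → Set
  Admissible G H = ∀ w → IsWeight H w → AdmissibleWrt G H w

module Submission where

-- Path consistency extends from paths to walks, so every walk from a to b has
-- the same signed length ℓ a b.  Connectivity in H^un is decidable, so each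
-- component gets a centre (start of a pair maximising ℓ on it), chosen
-- uniformly on the component, and w i = ℓ (centre i) i is a weight function
-- with w b = w a + slen r along any walk r from a to b (module Walks).
--
-- Admissibility is applied only to loops of H_comp: an edge (a , b) of G ∖ H
-- inside a component has slen r < 1 for every walk r from a to b.  With
-- transitivity of G this excludes directed paths a → b → c in H, so every
-- vertex is a source or a sink of H and walks from a source have signed
-- length 0 (ending at a source) or 1 (ending at a sink).  The partition is
-- into components, L (resp. R) are the vertices with an outgoing (incoming)
-- H-edge, and a G-edge from L to R inside a component must lie in H, as its
-- connecting walk has signed length 1 (module Decomposition).

open import Defs
open import Data.Nat using (ℕ)
open import Data.Fin using (Fin)
open import Data.Bool using (Bool; true)
open import Data.Product using (Σ; _×_)
open import Relation.Binary.PropositionalEquality using (_≡_)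
open import Relation.Nullary using (¬_)
open import Function.Bundles using (_⇔_)

open import Data.Nat as ℕ using (zero; suc; z≤n; s≤s)
import Data.Nat.Properties as ℕP
open import Data.Fin using (zero; suc)
import Data.Fin.Properties as FP
import Data.Bool as Bool
open import Data.Bool using (false)
open import Data.Integer as ℤ using (ℤ; +_; -_; +<+)
import Data.Integer.Properties as ℤP
open import Data.Integer.Tactic.RingSolver using (solve-∀)
open import Data.List using (List; []; _∷_; length; lookup; allFin; filter; cartesianProduct)
open import Data.List.Membership.Propositional using (_∈_; _∉_)
open import Data.List.Membership.Propositional.Properties
  using (∈-allFin; ∈-lookup; ∈-filter⁺; ∈-filter⁻; ∈-cartesianProduct⁺; ∈-cartesianProduct⁻)
import Data.List.Extrema
import Data.List.Properties as ListP
open import Data.List.Relation.Unary.Any using (here; there)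
import Data.List.Relation.Unary.All as All
open import Data.List.Relation.Unary.All using ([])
open import Data.List.Relation.Unary.All.Properties using (¬Any⇒All¬; All¬⇒¬Any)
open import Data.List.Relation.Unary.AllPairs using ([]; _∷_)
open import Data.List.Relation.Unary.Unique.Propositional using (Unique)
open import Data.Product using (_,_; proj₁; proj₂; ∃; uncurry)
open import Data.Sum using (_⊎_; inj₁; inj₂)
open import Data.Empty using (⊥; ⊥-elim)
open import Function.Base using (_∘_; id)
open import Function.Bundles using (mk⇔)
open import Function.Definitions using (Injective)
open import Relation.Nullary using (Dec; yes; no; does; map′; _×-dec_; _⊎-dec_; _→-dec_)
open import Relation.Nullary.Decidable using (dec-true)
open import Relation.Binary.PropositionalEquality using (refl; sym; trans; cong; subst; subst₂; module ≡-Reasoning)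

dec-witness : ∀ {A : Set} (d : Dec A) → does d ≡ true → A
dec-witness (yes a) _ = a

lookup-injective : ∀ {A : Set} {xs : List A} → Unique xs → Injective _≡_ _≡_ (lookup xs)
lookup-injective (x∉xs ∷ _) {zero} {zero} _ = refl
lookup-injective (x∉xs ∷ _) {zero} {suc j} eq = ⊥-elim (All.lookup x∉xs (∈-lookup j) eq)
lookup-injective (x∉xs ∷ _) {suc i} {zero} eq = ⊥-elim (All.lookup x∉xs (∈-lookup i) (sym eq))
lookup-injective (_ ∷ unique) {suc i} {suc j} eq = cong suc (lookup-injective unique eq)

unique-length≤ : ∀ {n} {xs : List (Fin n)} → Unique xs → length xs ℕ.≤ n
unique-length≤ unique = FP.injective⇒≤ (lookup-injective unique)

module Walks {n : ℕ} (H : Graph n) where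

  open import Data.List.Membership.DecPropositional (FP._≟_ {n}) using (_∈?_)

  Edge? : ∀ a b → Dec (Edge H a b)
  Edge? a b = H a b Bool.≟ true

  _++ʷ_ : ∀ {u v x} → Walk H u v → Walk H v x → Walk H u x
  nil _ ++ʷ q = q
  fwd e p ++ʷ q = fwd e (p ++ʷ q)
  bwd e p ++ʷ q = bwd e (p ++ʷ q)

  slen-++ : ∀ {u v x} (p : Walk H u v) (q : Walk H v x) → slen (p ++ʷ q) ≡ slen p ℤ.+ slen q
  slen-++ (nil _) q = sym (ℤP.+-identityˡ (slen q))
  slen-++ (fwd _ p) q = trans (cong ℤ.suc (slen-++ p q)) (sym (ℤP.+-assoc (+ 1) (slen p) (slen q)))
  slen-++ (bwd _ p) q = trans (cong ℤ.pred (slen-++ p q)) (sym (ℤP.+-assoc (- + 1) (slen p) (slen q)))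

  reverse : ∀ {u v} → Walk H u v → Walk H v u
  reverse (nil u) = nil u
  reverse (fwd e p) = reverse p ++ʷ bwd e (nil _)
  reverse (bwd e p) = reverse p ++ʷ fwd e (nil _)

  steps : ∀ {u v} → Walk H u v → ℕ
  steps (nil _) = 0
  steps (fwd _ p) = suc (steps p)
  steps (bwd _ p) = suc (steps p)

  length-vertices : ∀ {u v} (p : Walk H u v) → length (vertices p) ≡ suc (steps p)
  length-vertices (nil _) = refl
  length-vertices (fwd _ p) = cong suc (length-vertices p)
  length-vertices (bwd _ p) = cong suc (length-vertices p)

  path-steps< : ∀ {u v} {p : Walk H u v} → IsPath p → steps p ℕ.< n
  path-steps< {p = p} isPath = subst (ℕ._≤ n) (length-vertices p) (unique-length≤ isPath)

  dropUntil : ∀ {u v z} (p : Walk H u v) → IsPath p → z ∈ vertices p →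
              Σ (Walk H z v) λ q → IsPath q × (∀ {x} → x ∈ vertices q → x ∈ vertices p)
  dropUntil p@(nil _) isPath (here refl) = p , isPath , id
  dropUntil p@(fwd _ _) isPath (here refl) = p , isPath , id
  dropUntil p@(bwd _ _) isPath (here refl) = p , isPath , id
  dropUntil (fwd _ p) (_ ∷ isPath) (there z∈) with dropUntil p isPath z∈
  ... | q , isPath′ , q⊆p = q , isPath′ , there ∘ q⊆p
  dropUntil (bwd _ p) (_ ∷ isPath) (there z∈) with dropUntil p isPath z∈
  ... | q , isPath′ , q⊆p = q , isPath′ , there ∘ q⊆p

  pathAvoidingStart : ∀ {u v z} (p : Walk H u v) → IsPath p → z ∈ vertices p → ¬ z ≡ u →
                      Σ (Walk H z v) λ q → IsPath q × u ∉ vertices q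
  pathAvoidingStart (nil _) _ (here z≡u) z≢u = ⊥-elim (z≢u z≡u)
  pathAvoidingStart (fwd _ _) _ (here z≡u) z≢u = ⊥-elim (z≢u z≡u)
  pathAvoidingStart (bwd _ _) _ (here z≡u) z≢u = ⊥-elim (z≢u z≡u)
  pathAvoidingStart (fwd _ p) (u∉p ∷ isPath) (there z∈) _ with dropUntil p isPath z∈
  ... | q , isPath′ , q⊆p = q , isPath′ , All¬⇒¬Any u∉p ∘ q⊆p
  pathAvoidingStart (bwd _ p) (u∉p ∷ isPath) (there z∈) _ with dropUntil p isPath z∈
  ... | q , isPath′ , q⊆p = q , isPath′ , All¬⇒¬Any u∉p ∘ q⊆p

  toPath : ∀ {u v} → Walk H u v → Conn H u v
  toPath (nil u) = nil u , [] ∷ []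
  toPath {u} (fwd e w) with toPath w
  ... | p , isPath with u ∈? vertices p
  ...   | yes u∈p = let q , isPath′ , _ = dropUntil p isPath u∈p in q , isPath′
  ...   | no u∉p = fwd e p , ¬Any⇒All¬ (vertices p) u∉p ∷ isPath
  toPath {u} (bwd e w) with toPath w
  ... | p , isPath with u ∈? vertices p
  ...   | yes u∈p = let q , isPath′ , _ = dropUntil p isPath u∈p in q , isPath′
  ...   | no u∉p = bwd e p , ¬Any⇒All¬ (vertices p) u∉p ∷ isPath

  connRefl : ∀ u → Conn H u u
  connRefl u = nil u , [] ∷ []

  connSym : ∀ {u v} → Conn H u v → Conn H v u
  connSym (p , _) = toPath (reverse p)

  connTrans : ∀ {u v x} → Conn H u v → Conn H v x → Conn H u x
  connTrans (p , _) (q , _) = toPath (p ++ʷ q)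

  Within : ℕ → Fin n → Fin n → Set
  Within k x v = Σ (Walk H x v) λ w → steps w ℕ.≤ k

  within? : ∀ k x v → Dec (Within k x v)
  within? zero x v = map′ (λ { refl → nil x , z≤n }) (λ { (nil _ , _) → refl }) (x FP.≟ v)
  within? (suc k) x v =
    map′ fromStep toStep ((x FP.≟ v) ⊎-dec FP.any? λ y → (Edge? x y ⊎-dec Edge? y x) ×-dec within? k y v)
    where
    OneStep : Set
    OneStep = x ≡ v ⊎ ∃ λ y → (Edge H x y ⊎ Edge H y x) × Within k y v
    fromStep : OneStep → Within (suc k) x v
    fromStep (inj₁ refl) = nil x , z≤n
    fromStep (inj₂ (_ , inj₁ e , w , w≤k)) = fwd e w , s≤s w≤k
    fromStep (inj₂ (_ , inj₂ e , w , w≤k)) = bwd e w , s≤s w≤k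
    toStep : Within (suc k) x v → OneStep
    toStep (nil _ , _) = inj₁ refl
    toStep (fwd e w , s≤s w≤k) = inj₂ (_ , inj₁ e , w , w≤k)
    toStep (bwd e w , s≤s w≤k) = inj₂ (_ , inj₂ e , w , w≤k)

  -- Connectivity in H^un is decidable: search walks of at most n steps.
  conn? : ∀ u v → Dec (Conn H u v)
  conn? u v = map′ (toPath ∘ proj₁) (λ (p , isPath) → p , ℕP.<⇒≤ (path-steps< isPath)) (within? n u v)

  Source Sink : Fin n → Set
  Source x = ∀ z → ¬ Edge H z x
  Sink x = ∀ z → ¬ Edge H x z

  -- If H has no directed path of length 2, walks alternate between sources
  -- and sinks, so the signed length of a walk from a source is 0 or 1.
  module Alternating (noTwoPath : ∀ a b c → Edge H a b → Edge H b c → ⊥) where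

    fromSource : ∀ {x y} (w : Walk H x y) → Source x →
                 (slen w ≡ + 0 × Source y) ⊎ (slen w ≡ + 1 × Sink y)
    fromSink : ∀ {x y} (w : Walk H x y) → Sink x →
               (slen w ≡ + 0 × Sink y) ⊎ (slen w ≡ - + 1 × Source y)
    fromSource (nil _) source = inj₁ (refl , source)
    fromSource {x} (fwd {w = v} e w) _ with fromSink w (λ z → noTwoPath x v z e)
    ... | inj₁ (len , sink) = inj₂ (cong ℤ.suc len , sink)
    ... | inj₂ (len , source) = inj₁ (cong ℤ.suc len , source)
    fromSource (bwd {w = v} e _) source = ⊥-elim (source v e)
    fromSink (nil _) sink = inj₁ (refl , sink)
    fromSink (fwd {w = v} e _) sink = ⊥-elim (sink v e)
    fromSink {x} (bwd {w = v} e w) _ with fromSource w (λ z e′ → noTwoPath z v x e′ e)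
    ... | inj₁ (len , source) = inj₂ (cong ℤ.pred len , source)
    ... | inj₂ (len , sink) = inj₁ (cong ℤ.pred len , sink)

  module Consistent (consistent : PathConsistent H) (loopFree : ∀ x → ¬ Edge H x x) where

    -- Induction on a walk u → x → … → v, compared with a path p from u: if x
    -- is not on p, the reversed first step followed by p is a path from x;
    -- otherwise the first step followed by the part of p after x is a path
    -- from u, which by consistency has the signed length of p.
    walk-slen : ∀ {u v} (w : Walk H u v) (p : Walk H u v) → IsPath p → slen w ≡ slen p
    walk-slen (nil u) p isPath = consistent u u (nil u) p ([] ∷ []) isPath
    walk-slen {u} {v} (fwd {w = x} e w) p isPath with x ∈? vertices p
    ... | no x∉p = trans (cong ℤ.suc (walk-slen w (bwd e p) (¬Any⇒All¬ _ x∉p ∷ isPath)))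
                         (ℤP.suc-pred (slen p))
    ... | yes x∈p with pathAvoidingStart p isPath x∈p (λ { refl → loopFree u e })
    ...   | q , isPath′ , u∉q = trans (cong ℤ.suc (walk-slen w q isPath′))
                                      (consistent u v (fwd e q) p (¬Any⇒All¬ _ u∉q ∷ isPath′) isPath)
    walk-slen {u} {v} (bwd {w = x} e w) p isPath with x ∈? vertices p
    ... | no x∉p = trans (cong ℤ.pred (walk-slen w (fwd e p) (¬Any⇒All¬ _ x∉p ∷ isPath)))
                         (ℤP.pred-suc (slen p))
    ... | yes x∈p with pathAvoidingStart p isPath x∈p (λ { refl → loopFree u e })
    ...   | q , isPath′ , u∉q = trans (cong ℤ.pred (walk-slen w q isPath′))
                                      (consistent u v (bwd e q) p (¬Any⇒All¬ _ u∉q ∷ isPath′) isPath)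

    -- ℓ a b: the common signed length of all walks from a to b (0 if none);
    -- it is used only through ℓ-walk, so it is kept opaque.
    opaque
      ℓ : Fin n → Fin n → ℤ
      ℓ a b with conn? a b
      ... | yes (p , _) = slen p
      ... | no _ = + 0

      ℓ-walk : ∀ {a b} (w : Walk H a b) → slen w ≡ ℓ a b
      ℓ-walk {a} {b} w with conn? a b
      ... | yes (p , isPath) = walk-slen w p isPath
      ... | no disconnected = ⊥-elim (disconnected (toPath w))

    component : Fin n → List (Fin n)
    component i = filter (conn? i) (allFin n)

    ∈-component : ∀ {i x} → Conn H i x → x ∈ component i
    ∈-component {i} {x} = ∈-filter⁺ (conn? i) (∈-allFin x)

    component-conn : ∀ {i x} → x ∈ component i → Conn H i x
    component-conn {i} x∈ = proj₂ (∈-filter⁻ (conn? i) {xs = allFin n} x∈)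

    component-cong : ∀ {i j} → Conn H i j → component i ≡ component j
    component-cong {i} {j} i~j =
      ListP.filter-≐ (conn? i) (conn? j) (connTrans (connSym i~j) , connTrans i~j) (allFin n)

    IsCentre : List (Fin n) → Fin n → Set
    IsCentre xs u = u ∈ xs × Σ (Fin n) λ v → v ∈ xs × (∀ a b → a ∈ xs → b ∈ xs → ℓ a b ℤ.≤ ℓ u v)

    isCentre? : ∀ xs u → Dec (IsCentre xs u)
    isCentre? xs u =
      (u ∈? xs) ×-dec FP.any? λ v → (v ∈? xs) ×-dec
        FP.all? λ a → FP.all? λ b → (a ∈? xs) →-dec ((b ∈? xs) →-dec (ℓ a b ℤ.≤? ℓ u v))

    centre-exists : ∀ i → ∃ (IsCentre (component i))
    centre-exists i = proj₁ best , proj₁ best∈ , proj₂ best , proj₂ best∈ , maximal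
      where
      open Data.List.Extrema ℤP.≤-totalOrder using (argmax; argmax-all; f[xs]≤f[argmax])
      InComponent² : Fin n × Fin n → Set
      InComponent² (a , b) = a ∈ component i × b ∈ component i
      pairs : List (Fin n × Fin n)
      pairs = cartesianProduct (component i) (component i)
      i∈ : i ∈ component i
      i∈ = ∈-component (connRefl i)
      best : Fin n × Fin n
      best = argmax (uncurry ℓ) (i , i) pairs
      best∈ : InComponent² best
      best∈ = argmax-all (uncurry ℓ) {P = InComponent²} (i∈ , i∈)
                (All.tabulate (∈-cartesianProduct⁻ (component i) (component i)))
      maximal : ∀ a b → a ∈ component i → b ∈ component i → ℓ a b ℤ.≤ ℓ (proj₁ best) (proj₂ best)
      maximal a b a∈ b∈ =
        All.lookup (f[xs]≤f[argmax] {f = uncurry ℓ} (i , i) pairs) (∈-cartesianProduct⁺ a∈ b∈)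

    -- The first centre of xs; the fallback d is irrelevant once a centre exists.
    firstCentre : List (Fin n) → Fin n → Fin n
    firstCentre xs d with FP.any? (isCentre? xs)
    ... | yes (u , _) = u
    ... | no _ = d

    firstCentre-isCentre : ∀ xs d → ∃ (IsCentre xs) → IsCentre xs (firstCentre xs d)
    firstCentre-isCentre xs d hasCentre with FP.any? (isCentre? xs)
    ... | yes (_ , isCentre) = isCentre
    ... | no noCentre = ⊥-elim (noCentre hasCentre)

    firstCentre-fallback : ∀ xs d d′ → ∃ (IsCentre xs) → firstCentre xs d ≡ firstCentre xs d′
    firstCentre-fallback xs d d′ hasCentre with FP.any? (isCentre? xs)
    ... | yes _ = refl
    ... | no noCentre = ⊥-elim (noCentre hasCentre)

    -- The chosen vertex u_* of the component of i; it depends only on the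
    -- component.  It is used only through the two properties below.
    opaque
      centre : Fin n → Fin n
      centre i = firstCentre (component i) i

      centre-isCentre : ∀ i → IsCentre (component i) (centre i)
      centre-isCentre i = firstCentre-isCentre (component i) i (centre-exists i)

      centre-const : ∀ {i j} → Conn H i j → centre i ≡ centre j
      centre-const {i} {j} i~j =
        trans (firstCentre-fallback (component i) i j (centre-exists i))
              (cong (λ xs → firstCentre xs j) (component-cong i~j))

    conn-centre : ∀ i → Conn H i (centre i)
    conn-centre i = component-conn (proj₁ (centre-isCentre i))

    centre-maximal : ∀ i → Σ (Fin n) λ v → Conn H (centre i) v
      × (∀ a b → Conn H (centre i) a → Conn H (centre i) b → ℓ a b ℤ.≤ ℓ (centre i) v)
    centre-maximal i =
      let _ , v , v∈ , maximal = centre-isCentre i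
          i~ : ∀ {a} → Conn H (centre i) a → a ∈ component i
          i~ centre~a = ∈-component (connTrans (conn-centre i) centre~a)
      in v , connTrans (connSym (conn-centre i)) (component-conn v∈) ,
         λ a b centre~a centre~b → maximal a b (i~ centre~a) (i~ centre~b)

    weight : Fin n → ℤ
    weight i = ℓ (centre i) i

    weight-isWeight : IsWeight H weight
    weight-isWeight = centre , (λ i j → centre-const) , maximisingPath , pathFromCentre
      where
      maximisingPath : ∀ i → Σ (Fin n) λ v* → Σ (Walk H (centre i) v*) λ q → IsPath q
        × (∀ a b (r : Walk H a b) → IsPath r → Conn H (centre i) a → slen r ℤ.≤ slen q)
      maximisingPath i =
        let v , (q , isPath) , maximal = centre-maximal i
        in v , q , isPath , λ a b r isPathR centre~a →
             subst₂ ℤ._≤_ (sym (ℓ-walk r)) (sym (ℓ-walk q)) (maximal a b centre~a (connTrans centre~a (r , isPathR)))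
      pathFromCentre : ∀ i → Σ (Walk H (centre i) i) λ p → IsPath p × weight i ≡ slen p
      pathFromCentre i = let p , isPath = connSym (conn-centre i) in p , isPath , sym (ℓ-walk p)

    weight-shift : ∀ {a b} (r : Walk H a b) → weight b ≡ weight a ℤ.+ slen r
    weight-shift {a} {b} r = begin
      ℓ (centre b) b                 ≡⟨ cong (λ c → ℓ c b) (sym (centre-const (toPath r))) ⟩
      ℓ (centre a) b                 ≡⟨ sym (ℓ-walk (toCentre ++ʷ r)) ⟩
      slen (toCentre ++ʷ r)          ≡⟨ slen-++ toCentre r ⟩
      slen toCentre ℤ.+ slen r       ≡⟨ cong (ℤ._+ slen r) (ℓ-walk toCentre) ⟩
      ℓ (centre a) a ℤ.+ slen r      ∎
      where
      open ≡-Reasoning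
      toCentre : Walk H (centre a) a
      toCentre = proj₁ (connSym (conn-centre a))

module Decomposition (n : ℕ) (G H : Graph n)
  (increasing : EdgesIncreasing G) (closed : TransitivelyClosed G) (H⊆G : Subgraph H G)
  (consistent : PathConsistent H) (admissible : Admissible G H) where

  open Walks H

  loopFree : ∀ x → ¬ Edge H x x
  loopFree x e = FP.<-irrefl refl (increasing x x (H⊆G x x e))

  open Consistent consistent loopFree public

  shift-difference : ∀ x s → (x ℤ.- (x ℤ.+ s)) ℤ.+ + 0 ≡ - s
  shift-difference = solve-∀

  -- Admissibility for a loop of H_comp: an edge (a , b) of G ∖ H whose ends
  -- are joined by a walk r in H forces slen r < 1.
  loop-bound : ∀ {a b} → Edge G a b → H a b ≡ false → (r : Walk H a b) → slen r ℤ.< + 1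
  loop-bound {a} {b} ab∈G ab∉H r =
    ℤP.neg-cancel-< (subst (- + 1 ℤ.<_) weightDrop (admissible weight weight-isWeight 0 loop))
    where
    loop : CompCycle G H 0
    loop = record { src = λ _ → a ; tgt = λ _ → b ; inG = λ _ → ab∈G ; notH = λ _ → ab∉H
                  ; link = λ () ; close = connSym (toPath r) ; distinct = λ { zero zero _ → refl } }
    weightDrop : (weight a ℤ.- weight b) ℤ.+ + 0 ≡ - slen r
    weightDrop = trans (cong (λ wb → (weight a ℤ.- wb) ℤ.+ + 0) (weight-shift r)) (shift-difference (weight a) (slen r))

  -- H contains no directed path a → b → c: the edge (a , c) of G would either
  -- lie in H, contradicting path consistency, or violate the loop bound.
  no-two-path : ∀ a b c → Edge H a b → Edge H b c → ⊥
  no-two-path a b c ab bc with H a c in ac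
  ... | true = 2≢1 (trans (ℓ-walk (fwd ab (fwd bc (nil c)))) (sym (ℓ-walk (fwd ac (nil c)))))
    where
    2≢1 : ¬ (+ 2 ≡ + 1)
    2≢1 ()
  ... | false = 2≮1 (loop-bound {a} {c} (closed a b c (H⊆G a b ab) (H⊆G b c bc)) ac (fwd ab (fwd bc (nil c))))
    where
    2≮1 : ¬ (+ 2 ℤ.< + 1)
    2≮1 (+<+ (s≤s ()))

  open Alternating no-two-path

  L R : Fin n → Bool
  L v = does (FP.any? (Edge? v))
  R v = does (FP.any? λ u → Edge? u v)

  -- Since H has no directed 2-paths, L-vertices are sources and R-vertices are not.
  L-source : ∀ {a} → L a ≡ true → Source a
  L-source {a} La z za with dec-witness (FP.any? (Edge? a)) La
  ... | y , ay = no-two-path z a y za ay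

  R-not-source : ∀ {b} → R b ≡ true → ¬ Source b
  R-not-source {b} Rb source = let u , ub = dec-witness (FP.any? λ u → Edge? u b) Rb in source u ub

  L-R-disjoint : ∀ v → ¬ (L v ≡ true × R v ≡ true)
  L-R-disjoint v (Lv , Rv) = R-not-source Rv (L-source Lv)

  same-centre-walk : ∀ {a b} → centre a ≡ centre b → Walk H a b
  same-centre-walk {a} {b} same =
    proj₁ (connTrans (conn-centre a) (subst (λ c → Conn H c b) (sym same) (connSym (conn-centre b))))

  -- An edge of G from L to R within a component lies in H: otherwise the
  -- connecting walk starts at a source (as L a) and cannot end at a source
  -- (as R b), so it has signed length 1, contradicting the loop bound.
  edge-in-H : ∀ {a b} → Edge G a b → centre a ≡ centre b → L a ≡ true → R b ≡ true → Edge H a b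
  edge-in-H {a} {b} ab∈G same La Rb with H a b in ab
  ... | true = refl
  ... | false with fromSource (same-centre-walk same) (L-source La)
  ...   | inj₁ (_ , sourceB) = ⊥-elim (R-not-source Rb sourceB)
  ...   | inj₂ (len , _) = ⊥-elim (ℤP.<-irrefl len (loop-bound {a} {b} ab∈G ab (same-centre-walk same)))

  edge-characterisation : ∀ a b → Edge H a b ⇔ (Edge G a b × centre a ≡ centre b × L a ≡ true × R b ≡ true)
  edge-characterisation a b = mk⇔
    (λ ab → H⊆G a b ab , centre-const (toPath (fwd ab (nil b))) ,
            dec-true (FP.any? (Edge? a)) (b , ab) , dec-true (FP.any? λ u → Edge? u b) (a , ab))
    (λ (ab∈G , same , La , Rb) → edge-in-H ab∈G same La Rb)

proposition5p7 : (n : ℕ) (G H : Graph n) →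
    EdgesIncreasing G → TransitivelyClosed G → Subgraph H G →
    PathConsistent H → Admissible G H →
    Σ (Fin n → Fin n) λ p → Σ (Fin n → Bool) λ L → Σ (Fin n → Bool) λ R →
      (∀ v → ¬ (L v ≡ true × R v ≡ true))
      × (∀ a b → Edge H a b ⇔ (Edge G a b × p a ≡ p b × L a ≡ true × R b ≡ true))
proposition5p7 n G H increasing closed H⊆G consistent admissible =
  centre , L , R , L-R-disjoint , edge-characterisation
  where open Decomposition n G H increasing closed H⊆G consistent admissible
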